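{- Let $r\ge2$, $k\ge1$ and $m\ge1$ be integers. Then $\operatorname{forb}(m,r,K_k)=\sum_{i=0}^{k-1}\binom{m}{i}(r-1)^{m-i}$. Moreover, if $p\ge1$ is an integer with $(r-1)^{m-k}\ge p-1$, then \[\operatorname{forb}(m,r,p\cdot K_k)=\sum_{i=0}^{k-1}\binom{m}{i}(r-1)^{m-i}+(p-1)\binom{m}{k}.\]
   Context: An $r$-matrix is a matrix with entries in $\{0,1,\dots,r-1\}$. A matrix is simple if it has no repeated columns. For matrices $F$ and $A$, $A$ avoids $F$ if no submatrix of $A$ is a row and column permutation of $F$. $\operatorname{forb}(m,r,F)$ is the maximum number of columns of a simple $m$-rowed $r$-matrix that avoids $F$. $K_k$ is the $k\times2^k$ $(0,1)$-matrix whose columns are all $2^k$ distinct $(0,1)$-vectors of length $k$. For a positive integer $p$, $p\cdot F$ denotes $p$ copies of $F$ placed side by side (each column repeated $p$ times). -}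

module Defs where

open import Data.Nat using (ℕ; zero; suc; _+_; _*_; _∸_; _^_; _≤_; _/_; _%_)
open import Data.Nat.Combinatorics using (_C_)
open import Data.Fin using (Fin; toℕ)
open import Data.List using (map; upTo)
open import Data.Nat.ListAction using (sum)
open import Data.Product using (Σ; _×_)
open import Function.Definitions using (Injective)
open import Relation.Binary.PropositionalEquality using (_≡_)
open import Relation.Nullary using (¬_)

Matrix : ℕ → ℕ → ℕ → Set
Matrix m n r = Fin m → Fin n → Fin r

Simple : ∀ {m n r} → Matrix m n r → Set
Simple {m} {n} A = ∀ (j j' : Fin n) → (∀ (i : Fin m) → A i j ≡ A i j') → j ≡ j'

-- A contains F if some submatrix of A is a row and column permutation of F,
-- i.e. there are injective row/column selections ρ, γ with A (ρ i) (γ j) = F i j.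
Contains : ∀ {m n r k l} → Matrix m n r → (Fin k → Fin l → ℕ) → Set
Contains {m} {n} {r} {k} {l} A F =
  Σ (Fin k → Fin m) λ ρ → Σ (Fin l → Fin n) λ γ →
    Injective _≡_ _≡_ ρ × Injective _≡_ _≡_ γ ×
    (∀ (i : Fin k) (j : Fin l) → toℕ (A (ρ i) (γ j)) ≡ F i j)

Avoids : ∀ {m n r k l} → Matrix m n r → (Fin k → Fin l → ℕ) → Set
Avoids A F = ¬ Contains A F

-- forb(m, r, F) = v : v is the maximum number of columns of a simple m-rowed
-- r-matrix avoiding F (attained, and an upper bound).
ForbIs : (m r : ℕ) → ∀ {k l} → (Fin k → Fin l → ℕ) → ℕ → Set
ForbIs m r F v =
  (Σ (Matrix m v r) λ A → Simple A × Avoids A F) ×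
  (∀ (n : ℕ) (A : Matrix m n r) → Simple A → Avoids A F → n ≤ v)

bit : ℕ → ℕ → ℕ
bit c zero    = c % 2
bit c (suc i) = bit (c / 2) i

-- K_k : column j is the binary expansion of j (all 2^k distinct 0/1 columns).
K : (k : ℕ) → Fin k → Fin (2 ^ k) → ℕ
K k i j = bit (toℕ j) (toℕ i)

-- p · K_k : column c is column (c mod 2^k) of K_k, so each column of K_k
-- appears exactly p times.
pK : (p k : ℕ) → Fin k → Fin (p * 2 ^ k) → ℕ
pK p k i c = bit (toℕ c) (toℕ i)

bound : (m r k : ℕ) → ℕ
bound m r k = sum (map (λ i → (m C i) * ((r ∸ 1) ^ (m ∸ i))) (upTo k))

module Submission where

-- Fix r = 2 + r' and view an m-rowed simple r-matrix as the
-- duplicate-free list of its columns, each a vector in {0,…,r-1}^m.  Such a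
-- list contains K_k exactly when it "shatters" some k rows: every 0/1 pattern
-- occurs on those rows.
--  * Upper bound for K_k (a Sauer–Shelah type lemma): a family of vectors of
--    length m shattering no k rows has at most β(m,k) members, where
--    β(m+1,k+1) = (r-1)·β(m,k+1) + β(m,k).  Split by the first coordinate:
--    symbols 2,…,r-1 each contribute a family shattering no k+1 rows; the
--    symbols 0 and 1 contribute a union shattering no k+1 rows plus an
--    intersection shattering no k rows.  Unfolding β gives the closed form
--    Σ_{i<k} C(m,i)(r-1)^{m-i} of the statement.
--  * Lower bound for K_k: the β(m,k) vectors with fewer than k zeros; any
--    copy of K_k has an all-zero column on its k rows.
--  * Upper bound for p·K_k: for every k-set of rows some 0/1 pattern occurs
--    fewer than p times there (otherwise p·K_k is found).  Deleting these
--    ≤ (p-1)·C(m,k) columns leaves a family shattering no k rows.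
--  * Lower bound for p·K_k: add to the K_k-extremal family, for every k-set
--    of rows, p-1 vectors whose zeros lie exactly on that set (possible as
--    (r-1)^{m-k} ≥ p-1).  The p all-zero columns of a copy of p·K_k would
--    all have to share one zero set, which offers only p-1 vectors.

open import Defs
open import Data.Bool using (Bool; true; false)
open import Data.Empty using (⊥; ⊥-elim)
open import Data.Fin as Fin using (Fin; toℕ; fromℕ<; cast; punchIn; punchOut)
  renaming (zero to fz; suc to fs)
import Data.Fin.Properties as Finₚ
open import Data.List as List
  using (List; []; _∷_; length; _++_; map; filter; concat; take; applyUpTo)
open import Data.List.Properties
  using (length-++; length-map; length-tabulate; length-take)
open import Data.List.Membership.Propositional using (_∈_)
open import Data.List.Membership.Propositional.Properties
  using (∈-map⁺; ∈-map⁻; ∈-++⁺ˡ; ∈-++⁺ʳ; ∈-++⁻; ∈-filter⁻; ∈-tabulate⁻; ∈-lookup;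
         ∈-concat⁻′)
open import Data.List.Relation.Unary.Any as Any using (Any; here; there; any?)
open import Data.List.Relation.Unary.Any.Properties using (lookup-index)
open import Data.List.Relation.Unary.All as All using (All; []; _∷_)
open import Data.List.Relation.Unary.All.Properties using (¬All⇒Any¬)
open import Data.List.Relation.Unary.Unique.Propositional using (Unique; []; _∷_)
import Data.List.Relation.Unary.Unique.Propositional.Properties as Uniqueₚ
open import Data.Nat
  using (ℕ; zero; suc; _+_; _*_; _∸_; _^_; _≤_; _<_; z≤n; s≤s; _/_; _%_;
         NonZero; _<?_; _≤?_)
  renaming (_≟_ to _≟ℕ_)
open import Data.Nat.Properties
open import Data.Nat.Combinatorics using (_C_; nCk+nC[k+1]≡[n+1]C[k+1]; k>n⇒nCk≡0)
open import Data.Nat.DivMod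
  using (m≡m%n+[m/n]*n; m%n<n; m<n*o⇒m/o<n; [m+kn]%n≡m%n; +-distrib-/-∣ʳ; m*n/n≡m)
open import Data.Nat.Divisibility using (divides)
open import Data.Nat.ListAction using (sum)
open import Data.Nat.Solver using (module +-*-Solver)
open import Data.Product using (Σ; _×_; _,_; proj₁; proj₂)
open import Data.Sum using (_⊎_; inj₁; inj₂)
open import Data.Vec as Vec using (Vec; []; _∷_; lookup)
open import Data.Vec.Properties
  using (lookup-map; lookup∘tabulate; tabulate∘lookup; tabulate-cong; ∷-injectiveˡ;
         ∷-injectiveʳ; ≡-dec)
open import Function.Definitions using (Injective)
open import Relation.Binary.Definitions using (DecidableEquality)
open import Relation.Binary.PropositionalEquality
open import Relation.Nullary using (¬_; Dec; yes; no; ¬?)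
open import Relation.Nullary.Decidable using (decidable-stable)

open +-*-Solver using (solve; _:+_; _:*_; _:=_; con)

Inj : ∀ {k m} → (Fin k → Fin m) → Set
Inj ρ = Injective _≡_ _≡_ ρ

-- Counting lemmas for lists

sum-mono : ∀ {A : Set} (f g : A → ℕ) (xs : List A) → (∀ a → f a ≤ g a) →
  sum (map f xs) ≤ sum (map g xs)
sum-mono f g []       le = z≤n
sum-mono f g (x ∷ xs) le = +-mono-≤ (le x) (sum-mono f g xs le)

sum-mono-< : ∀ {A : Set} (f g : A → ℕ) (xs : List A) → (∀ a → f a ≤ g a) →
  Any (λ a → f a < g a) xs → sum (map f xs) < sum (map g xs)
sum-mono-< f g (x ∷ xs) le (here lt) = +-mono-<-≤ lt (sum-mono f g xs le)
sum-mono-< f g (x ∷ xs) le (there a) = +-mono-≤-< (le x) (sum-mono-< f g xs le a)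

sum-≤-length* : ∀ {A : Set} (f : A → ℕ) (xs : List A) B → (∀ {a} → a ∈ xs → f a ≤ B) →
  sum (map f xs) ≤ length xs * B
sum-≤-length* f []       B le = z≤n
sum-≤-length* f (x ∷ xs) B le = +-mono-≤ (le (here refl)) (sum-≤-length* f xs B (λ q → le (there q)))

length-filter-split : ∀ {A : Set} {P : A → Set} (P? : ∀ x → Dec (P x)) xs →
  length xs ≡ length (filter P? xs) + length (filter (λ x → ¬? (P? x)) xs)
length-filter-split P? [] = refl
length-filter-split P? (x ∷ xs) with P? x
... | yes _ = cong suc (length-filter-split P? xs)
... | no _  = trans (cong suc (length-filter-split P? xs)) (sym (+-suc _ _))

length-filter-∷-≤ : ∀ {A : Set} {P : A → Set} (P? : ∀ a → Dec (P a)) x xs →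
  length (filter P? xs) ≤ length (filter P? (x ∷ xs))
length-filter-∷-≤ P? x xs with P? x
... | yes _ = n≤1+n _
... | no _  = ≤-refl

length-filter-∷-< : ∀ {A : Set} {P : A → Set} (P? : ∀ a → Dec (P a)) x xs → P x →
  length (filter P? xs) < length (filter P? (x ∷ xs))
length-filter-∷-< P? x xs px with P? x
... | yes _ = ≤-refl
... | no ¬px = ⊥-elim (¬px px)

survivors : ∀ {A B : Set} {P : B → A → Set} → (∀ b a → Dec (P b a)) → List B → List A → List A
survivors P? Bs = filter (λ a → All.all? (λ b → ¬? (P? b a)) Bs)

-- Union bound: every element either survives or is caught by some test.
length-≤-survivors+caught : ∀ {A B : Set} {P : B → A → Set} (P? : ∀ b a → Dec (P b a))
  (Bs : List B) (xs : List A) →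
  length xs ≤ length (survivors P? Bs xs) + sum (map (λ b → length (filter (P? b) xs)) Bs)
length-≤-survivors+caught P? Bs [] = z≤n
length-≤-survivors+caught P? Bs (x ∷ xs) with All.all? (λ b → ¬? (P? b x)) Bs
... | yes _ = s≤s (+-monoʳ-≤ _ (≤-trans (length-≤-survivors+caught P? Bs xs)
                  (+-monoʳ-≤ _ (sum-mono _ _ Bs (λ b → length-filter-∷-≤ (P? b) x xs)))))
... | no caught = begin-strict
  length xs                 ≤⟨ length-≤-survivors+caught P? Bs xs ⟩
  survivorCount + caughtOld <⟨ +-monoʳ-< survivorCount
                                 (sum-mono-< _ _ Bs (λ b → length-filter-∷-≤ (P? b) x xs) grows) ⟩
  survivorCount + caughtNew ∎
  where
  open ≤-Reasoning
  survivorCount caughtOld caughtNew : ℕ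
  survivorCount = length (survivors P? Bs xs)
  caughtOld = sum (map (λ b → length (filter (P? b) xs)) Bs)
  caughtNew = sum (map (λ b → length (filter (P? b) (x ∷ xs))) Bs)
  grows : Any (λ b → length (filter (P? b) xs) < length (filter (P? b) (x ∷ xs))) Bs
  grows = Any.map (λ {b} ¬¬p → length-filter-∷-< (P? b) x xs (decidable-stable (P? b x) ¬¬p))
                  (¬All⇒Any¬ (λ b → ¬? (P? b x)) Bs caught)

∈-take : ∀ {A : Set} n (xs : List A) {x} → x ∈ take n xs → x ∈ xs
∈-take (suc n) (y ∷ xs) (here e)   = here e
∈-take (suc n) (y ∷ xs) (there x∈) = there (∈-take n xs x∈)

unique-lookup-injective : ∀ {A : Set} (xs : List A) → Unique xs →
  ∀ {a b} → List.lookup xs a ≡ List.lookup xs b → a ≡ b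
unique-lookup-injective (x ∷ xs) (fresh ∷ u) {fz}   {fz}   e = refl
unique-lookup-injective (x ∷ xs) (fresh ∷ u) {fz}   {fs b} e = ⊥-elim (All.lookup fresh (∈-lookup b) e)
unique-lookup-injective (x ∷ xs) (fresh ∷ u) {fs a} {fz}   e = ⊥-elim (All.lookup fresh (∈-lookup a) (sym e))
unique-lookup-injective (x ∷ xs) (fresh ∷ u) {fs a} {fs b} e = cong fs (unique-lookup-injective xs u e)

record UnionIntersection {A : Set} (L₀ L₁ : List A) : Set where
  field
    union meet   : List A
    union-unique : Unique union
    meet-unique  : Unique meet
    ∈-union      : ∀ {x} → x ∈ union → x ∈ L₀ ⊎ x ∈ L₁
    ∈-meet       : ∀ {x} → x ∈ meet → x ∈ L₀ × x ∈ L₁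
    size         : length L₀ + length L₁ ≡ length union + length meet

unionIntersection : ∀ {A : Set} → DecidableEquality A → (L₀ L₁ : List A) →
  Unique L₀ → Unique L₁ → UnionIntersection L₀ L₁
unionIntersection {A} _≟_ L₀ L₁ u₀ u₁ = record
  { union        = L₀ ++ new
  ; meet         = old
  ; union-unique = Uniqueₚ.++⁺ u₀ (Uniqueₚ.filter⁺ ∉L₀? u₁)
                     (λ (x∈L₀ , x∈new) → proj₂ (∈-filter⁻ ∉L₀? {xs = L₁} x∈new) x∈L₀)
  ; meet-unique  = Uniqueₚ.filter⁺ ∈L₀? u₁
  ; ∈-union      = ∈-union
  ; ∈-meet       = λ x∈old → let (x∈L₁ , x∈L₀) = ∈-filter⁻ ∈L₀? x∈old in x∈L₀ , x∈L₁
  ; size         = begin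
      length L₀ + length L₁               ≡⟨ cong (length L₀ +_) (length-filter-split ∈L₀? L₁) ⟩
      length L₀ + (length old + length new) ≡⟨ cong (length L₀ +_) (+-comm (length old) _) ⟩
      length L₀ + (length new + length old) ≡⟨ +-assoc (length L₀) _ _ ⟨
      length L₀ + length new + length old ≡⟨ cong (_+ length old) (length-++ L₀) ⟨
      length (L₀ ++ new) + length old     ∎
  }
  where
  open ≡-Reasoning
  ∈L₀? : ∀ x → Dec (x ∈ L₀)
  ∈L₀? x = any? (x ≟_) L₀
  ∉L₀? : ∀ x → Dec (¬ x ∈ L₀)
  ∉L₀? x = ¬? (∈L₀? x)
  old new : List A
  old = filter ∈L₀? L₁
  new = filter ∉L₀? L₁
  ∈-union : ∀ {x} → x ∈ L₀ ++ new → x ∈ L₀ ⊎ x ∈ L₁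
  ∈-union x∈ with ∈-++⁻ L₀ x∈
  ... | inj₁ x∈L₀  = inj₁ x∈L₀
  ... | inj₂ x∈new = inj₂ (proj₁ (∈-filter⁻ ∉L₀? x∈new))

ΣFin : ∀ n → (Fin n → ℕ) → ℕ
ΣFin zero    f = 0
ΣFin (suc n) f = f fz + ΣFin n (λ a → f (fs a))

ΣFin-cong : ∀ n {f g : Fin n → ℕ} → (∀ a → f a ≡ g a) → ΣFin n f ≡ ΣFin n g
ΣFin-cong zero    e = refl
ΣFin-cong (suc n) e = cong₂ _+_ (e fz) (ΣFin-cong n (λ a → e (fs a)))

ΣFin-≤ : ∀ n (f : Fin n → ℕ) B → (∀ a → f a ≤ B) → ΣFin n f ≤ n * B
ΣFin-≤ zero    f B le = z≤n
ΣFin-≤ (suc n) f B le = +-mono-≤ (le fz) (ΣFin-≤ n _ B (λ a → le (fs a)))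

ΣFin-zero : ∀ n → ΣFin n (λ _ → 0) ≡ 0
ΣFin-zero zero    = refl
ΣFin-zero (suc n) = ΣFin-zero n

ΣFin-bump : ∀ n (h : Fin n) (f g : Fin n → ℕ) → f h ≡ suc (g h) → (∀ a → a ≢ h → f a ≡ g a) →
  ΣFin n f ≡ suc (ΣFin n g)
ΣFin-bump (suc n) fz     f g at-h elsewhere =
  cong₂ _+_ at-h (ΣFin-cong n (λ a → elsewhere (fs a) (λ ())))
ΣFin-bump (suc n) (fs h) f g at-h elsewhere =
  trans (cong₂ _+_ (elsewhere fz (λ ())) (ΣFin-bump n h _ _ at-h (λ a a≢h → elsewhere (fs a) (λ e → a≢h (Finₚ.suc-injective e)))))
        (+-suc (g fz) _)

sumBelow : (ℕ → ℕ) → ℕ → ℕ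
sumBelow h zero    = 0
sumBelow h (suc n) = h 0 + sumBelow (λ i → h (suc i)) n

sum-applyUpTo : ∀ (g f : ℕ → ℕ) n → sum (map g (applyUpTo f n)) ≡ sumBelow (λ i → g (f i)) n
sum-applyUpTo g f zero    = refl
sum-applyUpTo g f (suc n) = cong (g (f 0) +_) (sum-applyUpTo g (λ i → f (suc i)) n)

sumBelow-cong : ∀ {f h : ℕ → ℕ} n → (∀ i → f i ≡ h i) → sumBelow f n ≡ sumBelow h n
sumBelow-cong zero    e = refl
sumBelow-cong (suc n) e = cong₂ _+_ (e 0) (sumBelow-cong n (λ i → e (suc i)))

sumBelow-+ : ∀ (f h : ℕ → ℕ) n → sumBelow (λ i → f i + h i) n ≡ sumBelow f n + sumBelow h n
sumBelow-+ f h zero    = refl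
sumBelow-+ f h (suc n) rewrite sumBelow-+ (λ i → f (suc i)) (λ i → h (suc i)) n =
  solve 4 (λ a b c d → (a :+ b) :+ (c :+ d) := (a :+ c) :+ (b :+ d)) refl (f 0) (h 0) _ _

sumBelow-* : ∀ c (f : ℕ → ℕ) n → sumBelow (λ i → c * f i) n ≡ c * sumBelow f n
sumBelow-* c f zero    = sym (*-zeroʳ c)
sumBelow-* c f (suc n) rewrite sumBelow-* c (λ i → f (suc i)) n = sym (*-distribˡ-+ c (f 0) _)

sumBelow-zero : ∀ n → sumBelow (λ _ → 0) n ≡ 0
sumBelow-zero zero    = refl
sumBelow-zero (suc n) = sumBelow-zero n

-- Binary digits

bit<2 : ∀ c i → bit c i < 2
bit<2 c zero    = m%n<n c 2
bit<2 c (suc i) = bit<2 (c / 2) i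

bit-of-0 : ∀ i → bit 0 i ≡ 0
bit-of-0 zero    = refl
bit-of-0 (suc i) = bit-of-0 i

patternOf : ∀ {k} → Fin (2 ^ k) → Fin k → Fin 2
patternOf j i = fromℕ< (bit<2 (toℕ j) (toℕ i))

bit-+-multiple : ∀ k (i : Fin k) s q → bit (s + q * 2 ^ k) (toℕ i) ≡ bit s (toℕ i)
bit-+-multiple (suc k) i s q =
  trans (cong (λ z → bit (s + z) (toℕ i)) q*2^[1+k]) (lower i)
  where
  q*2^[1+k] : q * 2 ^ suc k ≡ q * 2 ^ k * 2
  q*2^[1+k] = trans (cong (q *_) (*-comm 2 (2 ^ k))) (sym (*-assoc q (2 ^ k) 2))
  halve : (s + q * 2 ^ k * 2) / 2 ≡ s / 2 + q * 2 ^ k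
  halve = trans (+-distrib-/-∣ʳ s (divides (q * 2 ^ k) refl)) (cong (s / 2 +_) (m*n/n≡m (q * 2 ^ k) 2))
  lower : ∀ (i : Fin (suc k)) → bit (s + q * 2 ^ k * 2) (toℕ i) ≡ bit s (toℕ i)
  lower fz     = [m+kn]%n≡m%n s (q * 2 ^ k) 2
  lower (fs i) = trans (cong (λ z → bit z (toℕ i)) halve) (bit-+-multiple k i (s / 2) q)

bit-injective : ∀ k a b → a < 2 ^ k → b < 2 ^ k →
  (∀ (i : Fin k) → bit a (toℕ i) ≡ bit b (toℕ i)) → a ≡ b
bit-injective zero    zero    zero    _        _        _ = refl
bit-injective zero    (suc a) b       (s≤s ()) _        _
bit-injective zero    zero    (suc b) _        (s≤s ()) _
bit-injective (suc k) a       b       a<       b<       same = begin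
  a                   ≡⟨ m≡m%n+[m/n]*n a 2 ⟩
  a % 2 + (a / 2) * 2 ≡⟨ cong₂ (λ u v → u + v * 2) (same fz) halves ⟩
  b % 2 + (b / 2) * 2 ≡⟨ m≡m%n+[m/n]*n b 2 ⟨
  b                   ∎
  where
  open ≡-Reasoning
  half< : ∀ x → x < 2 ^ suc k → x / 2 < 2 ^ k
  half< x x< = m<n*o⇒m/o<n (subst (x <_) (*-comm 2 (2 ^ k)) x<)
  halves : a / 2 ≡ b / 2
  halves = bit-injective k (a / 2) (b / 2) (half< a a<) (half< b b<) (λ i → same (fs i))

-- Injections between finite sets

unsuc : ∀ {m} (x : Fin (suc m)) → x ≢ fz → Fin m
unsuc fz     x≢0 = ⊥-elim (x≢0 refl)
unsuc (fs x) _   = x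

fs-unsuc : ∀ {m} (x : Fin (suc m)) (x≢0 : x ≢ fz) → fs (unsuc x x≢0) ≡ x
fs-unsuc fz     x≢0 = ⊥-elim (x≢0 refl)
fs-unsuc (fs x) _   = refl

lowerInj : ∀ {k m} (ρ : Fin k → Fin (suc m)) → (∀ i → ρ i ≢ fz) → Inj ρ →
  Σ (Fin k → Fin m) λ ρ' → Inj ρ' × (∀ i → ρ i ≡ fs (ρ' i))
lowerInj ρ avoids inj =
  (λ i → unsuc (ρ i) (avoids i)) ,
  (λ {i} {j} e → inj (trans (sym (fs-unsuc (ρ i) (avoids i)))
                            (trans (cong fs e) (fs-unsuc (ρ j) (avoids j))))) ,
  (λ i → sym (fs-unsuc (ρ i) (avoids i)))

dropZero : ∀ {k m} (ρ : Fin (suc k) → Fin (suc m)) → Inj ρ → (j0 : Fin (suc k)) → ρ j0 ≡ fz →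
  Σ (Fin k → Fin m) λ ρ' → Inj ρ' × (∀ i → ρ (punchIn j0 i) ≡ fs (ρ' i))
dropZero ρ inj j0 ρj0≡0 =
  lowerInj (λ i → ρ (punchIn j0 i)) avoids (λ e → Finₚ.punchIn-injective j0 _ _ (inj e))
  where
  avoids : ∀ i → ρ (punchIn j0 i) ≢ fz
  avoids i e = Finₚ.punchInᵢ≢i j0 i (inj (trans e (sym ρj0≡0)))

extend : ∀ {k m} (i : Fin m) (ρ : Fin k → Fin m) → Fin (suc k) → Fin m
extend i ρ fz     = i
extend i ρ (fs j) = ρ j

extend-injective : ∀ {k m} (i : Fin m) (ρ : Fin k → Fin m) → Inj ρ → (∀ j → ρ j ≢ i) →
  Inj (extend i ρ)
extend-injective i ρ inj fresh {fz}   {fz}   e = refl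
extend-injective i ρ inj fresh {fz}   {fs b} e = ⊥-elim (fresh b (sym e))
extend-injective i ρ inj fresh {fs a} {fz}   e = ⊥-elim (fresh a e)
extend-injective i ρ inj fresh {fs a} {fs b} e = cong fs (inj e)

Surj : ∀ {k} → (Fin k → Fin k) → Set
Surj {k} π = ∀ (i' : Fin k) → Σ (Fin k) λ i → π i ≡ i'

insertZero : ∀ {k} → Fin (suc k) → (Fin k → Fin k) → Fin (suc k) → Fin (suc k)
insertZero j0 π j with j0 Finₚ.≟ j
... | yes _    = fz
... | no j0≢j = fs (π (punchOut j0≢j))

insertZero-surjective : ∀ {k} (j0 : Fin (suc k)) (π : Fin k → Fin k) → Surj π →
  Surj (insertZero j0 π)
insertZero-surjective j0 π onto fz = j0 , at-j0
  where
  at-j0 : insertZero j0 π j0 ≡ fz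
  at-j0 with j0 Finₚ.≟ j0
  ... | yes _    = refl
  ... | no j0≢j0 = ⊥-elim (j0≢j0 refl)
insertZero-surjective j0 π onto (fs i') with onto i'
... | i , πi≡i' = punchIn j0 i , at-punchIn
  where
  at-punchIn : insertZero j0 π (punchIn j0 i) ≡ fs i'
  at-punchIn with j0 Finₚ.≟ punchIn j0 i
  ... | yes j0≡ = ⊥-elim (Finₚ.punchInᵢ≢i j0 i (sym j0≡))
  ... | no j0≢  = cong fs (trans (cong π (trans (Finₚ.punchOut-cong j0 refl) (Finₚ.punchOut-punchIn j0))) πi≡i')

-- The k-subsets of the rows Fin m, listed as increasing injections
-- Fin k → Fin m (written as vectors); there are C(m,k) of them.
increasing : (m k : ℕ) → List (Vec (Fin m) k)
increasing m       zero    = [] ∷ []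
increasing zero    (suc k) = []
increasing (suc m) (suc k) =
  map (λ σ → fz ∷ Vec.map fs σ) (increasing m k) ++ map (Vec.map fs) (increasing m (suc k))

length-increasing : ∀ m k → length (increasing m k) ≡ m C k
length-increasing m       zero    = refl
length-increasing zero    (suc k) = refl
length-increasing (suc m) (suc k) = begin
  length (increasing (suc m) (suc k))
    ≡⟨ length-++ (map _ (increasing m k)) ⟩
  length (map _ (increasing m k)) + length (map _ (increasing m (suc k)))
    ≡⟨ cong₂ _+_ (length-map _ (increasing m k)) (length-map _ (increasing m (suc k))) ⟩
  length (increasing m k) + length (increasing m (suc k))
    ≡⟨ cong₂ _+_ (length-increasing m k) (length-increasing m (suc k)) ⟩
  m C k + m C suc k
    ≡⟨ nCk+nC[k+1]≡[n+1]C[k+1] m k ⟩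
  suc m C suc k ∎
  where open ≡-Reasoning

map-fs-injective : ∀ {m k} (σ : Vec (Fin m) k) → Inj (lookup σ) → Inj (lookup (Vec.map fs σ))
map-fs-injective σ inj {i} {j} e =
  inj (Finₚ.suc-injective (trans (sym (lookup-map i fs σ)) (trans e (lookup-map j fs σ))))

cons-zero-injective : ∀ {m k} (σ : Vec (Fin m) k) → Inj (lookup σ) →
  Inj (lookup (fz ∷ Vec.map fs σ))
cons-zero-injective σ inj {fz}   {fz}   e = refl
cons-zero-injective σ inj {fz}   {fs j} e = ⊥-elim (Finₚ.0≢1+n (trans e (lookup-map j fs σ)))
cons-zero-injective σ inj {fs i} {fz}   e =
  ⊥-elim (Finₚ.0≢1+n (sym (trans (sym (lookup-map i fs σ)) e)))
cons-zero-injective σ inj {fs i} {fs j} e = cong fs (map-fs-injective σ inj e)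

increasing-injective : ∀ m k {σ} → σ ∈ increasing m k → Inj (lookup σ)
increasing-injective m       zero    _ {()}
increasing-injective zero    (suc k) ()
increasing-injective (suc m) (suc k) σ∈ with ∈-++⁻ (map (λ σ → fz ∷ Vec.map fs σ) (increasing m k)) σ∈
... | inj₁ q with ∈-map⁻ (λ σ → fz ∷ Vec.map fs σ) q
...   | σ' , σ'∈ , refl = cons-zero-injective σ' (increasing-injective m k σ'∈)
increasing-injective (suc m) (suc k) σ∈ | inj₂ q with ∈-map⁻ (Vec.map fs) q
...   | σ' , σ'∈ , refl = map-fs-injective σ' (increasing-injective m (suc k) σ'∈)

record Factorisation {k m} (ρ : Fin k → Fin m) : Set where
  constructor factorisation
  field
    σ      : Vec (Fin m) k
    σ∈     : σ ∈ increasing m k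
    π      : Fin k → Fin k
    π-onto : Surj π
    ρ≡σ∘π  : ∀ i → ρ i ≡ lookup σ (π i)

factorise : ∀ m k (ρ : Fin k → Fin m) → Inj ρ → Factorisation ρ
factorise m       zero    ρ inj = factorisation [] (here refl) (λ ()) (λ ()) (λ ())
factorise zero    (suc k) ρ inj with ρ fz
... | ()
factorise (suc m) (suc k) ρ inj with Finₚ.any? (λ j → ρ j Finₚ.≟ fz)
... | no misses0 with lowerInj ρ (λ i e → misses0 (i , e)) inj
...   | ρ' , inj' , ρ≡fsρ' with factorise m (suc k) ρ' inj'
...     | factorisation σ' σ'∈ π onto eq =
  factorisation (Vec.map fs σ') (∈-++⁺ʳ (map (λ σ → fz ∷ Vec.map fs σ) (increasing m k)) (∈-map⁺ (Vec.map fs) σ'∈))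
    π onto (λ i → trans (ρ≡fsρ' i) (trans (cong fs (eq i)) (sym (lookup-map (π i) fs σ'))))
factorise (suc m) (suc k) ρ inj | yes (j0 , ρj0≡0) with dropZero ρ inj j0 ρj0≡0
... | ρ' , inj' , ρ∘punchIn≡fsρ' with factorise m k ρ' inj'
...   | factorisation σ' σ'∈ π' onto eq =
  factorisation (fz ∷ Vec.map fs σ') (∈-++⁺ˡ (∈-map⁺ (λ σ → fz ∷ Vec.map fs σ) σ'∈))
    (insertZero j0 π') (insertZero-surjective j0 π' onto) ρ≡σ∘π
  where
  ρ≡σ∘π : ∀ j → ρ j ≡ lookup (fz ∷ Vec.map fs σ') (insertZero j0 π' j)
  ρ≡σ∘π j with j0 Finₚ.≟ j
  ... | yes refl   = ρj0≡0
  ... | no j0≢j = begin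
    ρ j                                   ≡⟨ cong ρ (Finₚ.punchIn-punchOut j0≢j) ⟨
    ρ (punchIn j0 i)                      ≡⟨ ρ∘punchIn≡fsρ' i ⟩
    fs (ρ' i)                             ≡⟨ cong fs (eq i) ⟩
    fs (lookup σ' (π' i))                 ≡⟨ lookup-map (π' i) fs σ' ⟨
    lookup (Vec.map fs σ') (π' i)         ∎
    where
    open ≡-Reasoning
    i : Fin k
    i = punchOut j0≢j

zeros : ∀ {r m} → Vec (Fin (suc r)) m → ℕ
zeros []         = 0
zeros (fz ∷ v)   = suc (zeros v)
zeros (fs _ ∷ v) = zeros v

zeros-≥ : ∀ {r} m k (x : Vec (Fin (suc r)) m) (ρ : Fin k → Fin m) → Inj ρ →
  (∀ i → lookup x (ρ i) ≡ fz) → k ≤ zeros x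
zeros-≥ m       zero    x       ρ inj vanish = z≤n
zeros-≥ zero    (suc k) x       ρ inj vanish with ρ fz
... | ()
zeros-≥ (suc m) (suc k) (h ∷ t) ρ inj vanish with Finₚ.any? (λ j → ρ j Finₚ.≟ fz)
... | yes (j0 , ρj0≡0) with dropZero ρ inj j0 ρj0≡0
...   | ρ' , inj' , eq = subst (λ h → suc k ≤ zeros (h ∷ t)) h≡0
          (s≤s (zeros-≥ m k t ρ' inj' (λ i → trans (sym (cong (lookup (h ∷ t)) (eq i))) (vanish (punchIn j0 i)))))
  where
  h≡0 : fz ≡ h
  h≡0 = sym (trans (cong (lookup (h ∷ t)) (sym ρj0≡0)) (vanish j0))
zeros-≥ (suc m) (suc k) (h ∷ t) ρ inj vanish | no misses0 with lowerInj ρ (λ i e → misses0 (i , e)) inj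
... | ρ' , inj' , eq =
  ≤-trans (zeros-≥ m (suc k) t ρ' inj' (λ i → trans (sym (cong (lookup (h ∷ t)) (eq i))) (vanish i)))
          (zeros-tail h)
  where
  zeros-tail : ∀ h → zeros t ≤ zeros (h ∷ t)
  zeros-tail fz     = n≤1+n _
  zeros-tail (fs _) = ≤-refl

module OverAlphabet (r' : ℕ) where

  R : ℕ
  R = suc (suc r')

  Column : ℕ → Set
  Column m = Vec (Fin R) m

  zeroSym oneSym : Fin R
  zeroSym = fz
  oneSym  = fs fz

  Shows : ∀ {k m} → Column m → (Fin k → Fin m) → (Fin k → Fin 2) → Set
  Shows x ρ b = ∀ i → toℕ (lookup x (ρ i)) ≡ toℕ (b i)

  shows? : ∀ {k m} (x : Column m) (ρ : Fin k → Fin m) (b : Fin k → Fin 2) → Dec (Shows x ρ b)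
  shows? x ρ b = Finₚ.all? (λ i → toℕ (lookup x (ρ i)) ≟ℕ toℕ (b i))

  Shatters : ∀ {m} → (Column m → Set) → ℕ → Set
  Shatters {m} P k = Σ (Fin k → Fin m) λ ρ → Inj ρ ×
    ((b : Fin k → Fin 2) → Σ (Column m) λ x → P x × Shows x ρ b)

  shatters-mono : ∀ {m k} {P Q : Column m → Set} → (∀ x → P x → Q x) → Shatters P k → Shatters Q k
  shatters-mono P⊆Q (ρ , inj , shown) =
    ρ , inj , λ b → let (x , px , sh) = shown b in x , P⊆Q x px , sh

  -- Shattering by the tails of a family lifts to the family (use rows 1,…,m).
  shatters-tail : ∀ {m k} {P : Column (suc m) → Set} →
    Shatters (λ t → Σ (Fin R) λ a → P (a ∷ t)) k → Shatters P k
  shatters-tail (ρ , inj , shown) =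
    (λ i → fs (ρ i)) , (λ e → inj (Finₚ.suc-injective e)) ,
    λ b → let (t , (a , p) , sh) = shown b in a ∷ t , p , sh

  shatters-extend : ∀ {m k} {P : Column (suc m) → Set} →
    Shatters (λ t → P (zeroSym ∷ t) × P (oneSym ∷ t)) k → Shatters P (suc k)
  shatters-extend {m} {k} {P} (ρ , inj , shown) =
    ρ⁺ , extend-injective fz _ (λ e → inj (Finₚ.suc-injective e)) (λ j ()) , shown⁺
    where
    ρ⁺ : Fin (suc k) → Fin (suc m)
    ρ⁺ = extend fz (λ i → fs (ρ i))
    shown⁺ : (b : Fin (suc k) → Fin 2) → Σ (Column (suc m)) λ x → P x × Shows x ρ⁺ b
    shown⁺ b with shown (λ i → b (fs i)) | b fz in b0
    ... | t , (p₀ , p₁) , sh | fz = zeroSym ∷ t , p₀ , sh⁺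
      where
      sh⁺ : Shows (zeroSym ∷ t) ρ⁺ b
      sh⁺ fz     = cong toℕ (sym b0)
      sh⁺ (fs i) = sh i
    ... | t , (p₀ , p₁) , sh | fs fz = oneSym ∷ t , p₁ , sh⁺
      where
      sh⁺ : Shows (oneSym ∷ t) ρ⁺ b
      sh⁺ fz     = cong toℕ (sym b0)
      sh⁺ (fs i) = sh i

  β : ℕ → ℕ → ℕ
  β m       zero    = 0
  β zero    (suc k) = 1
  β (suc m) (suc k) = suc r' * β m (suc k) + β m k

  slice : ∀ {m} → Fin R → List (Column (suc m)) → List (Column m)
  slice a []             = []
  slice a ((h ∷ t) ∷ L) with h Finₚ.≟ a
  ... | yes _ = t ∷ slice a L
  ... | no _  = slice a L

  slice-∈ : ∀ {m} a (L : List (Column (suc m))) {t} → t ∈ slice a L → (a ∷ t) ∈ L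
  slice-∈ a ((h ∷ t) ∷ L) t∈ with h Finₚ.≟ a
  slice-∈ a ((a ∷ t) ∷ L) (here refl) | yes refl = here refl
  slice-∈ a ((h ∷ t) ∷ L) (there t∈)  | yes _    = there (slice-∈ a L t∈)
  slice-∈ a ((h ∷ t) ∷ L) t∈          | no _     = there (slice-∈ a L t∈)

  slice-unique : ∀ {m} a (L : List (Column (suc m))) → Unique L → Unique (slice a L)
  slice-unique a []             _         = []
  slice-unique a ((h ∷ t) ∷ L) (fresh ∷ u) with h Finₚ.≟ a
  ... | no _     = slice-unique a L u
  ... | yes refl =
    All.tabulate (λ y∈ t≡y → All.lookup fresh (slice-∈ a L y∈) (cong (h ∷_) t≡y)) ∷ slice-unique a L u

  length-slices : ∀ {m} (L : List (Column (suc m))) → length L ≡ ΣFin R (λ a → length (slice a L))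
  length-slices []             = sym (ΣFin-zero R)
  length-slices ((h ∷ t) ∷ L) = sym (trans
    (ΣFin-bump R h (λ a → length (slice a ((h ∷ t) ∷ L))) (λ a → length (slice a L)) at-h elsewhere)
    (cong suc (sym (length-slices L))))
    where
    at-h : length (slice h ((h ∷ t) ∷ L)) ≡ suc (length (slice h L))
    at-h with h Finₚ.≟ h
    ... | yes _   = refl
    ... | no h≢h = ⊥-elim (h≢h refl)
    elsewhere : ∀ a → a ≢ h → length (slice a ((h ∷ t) ∷ L)) ≡ length (slice a L)
    elsewhere a a≢h with h Finₚ.≟ a
    ... | yes h≡a = ⊥-elim (a≢h (sym h≡a))
    ... | no _    = refl

  shatter-bound : ∀ m k (L : List (Column m)) → Unique L → ¬ Shatters (_∈ L) k → length L ≤ β m k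
  -- A non-empty family shatters the empty set of rows; with m = 0 there is
  -- only one column.
  shatter-bound m       zero    []      u ¬sh = z≤n
  shatter-bound m       zero    (x ∷ L) u ¬sh = ⊥-elim (¬sh ((λ ()) , (λ { {()} }) , λ b → x , here refl , λ ()))
  shatter-bound zero    (suc k) []                u ¬sh = z≤n
  shatter-bound zero    (suc k) ([] ∷ [])         u ¬sh = s≤s z≤n
  shatter-bound zero    (suc k) ([] ∷ [] ∷ L) ((distinct ∷ _) ∷ _) ¬sh = ⊥-elim (distinct refl)
  shatter-bound (suc m) (suc k) L u ¬sh = begin
    length L                                  ≡⟨ length-slices L ⟩
    N zeroSym + (N oneSym + ΣFin r' (λ a → N (fs (fs a))))
                                              ≡⟨ +-assoc (N zeroSym) (N oneSym) _ ⟨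
    (N zeroSym + N oneSym) + ΣFin r' (λ a → N (fs (fs a)))
                                              ≤⟨ +-mono-≤ zero-one-slices
                                                   (ΣFin-≤ r' _ (β m (suc k)) (λ a → slice-bound (fs (fs a)))) ⟩
    (β m (suc k) + β m k) + r' * β m (suc k)  ≡⟨ solve 3 (λ b c r → (b :+ c) :+ r :* b := (b :+ r :* b) :+ c)
                                                   refl (β m (suc k)) (β m k) r' ⟩
    β (suc m) (suc k)                         ∎
    where
    open ≤-Reasoning
    N : Fin R → ℕ
    N a = length (slice a L)
    -- Any single slice shatters no k+1 rows.
    slice-bound : ∀ a → N a ≤ β m (suc k)
    slice-bound a = shatter-bound m (suc k) (slice a L) (slice-unique a L u)
      (λ sh → ¬sh (shatters-tail (shatters-mono (λ t t∈ → a , slice-∈ a L t∈) sh)))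
    open UnionIntersection (unionIntersection (≡-dec Finₚ._≟_) (slice zeroSym L) (slice oneSym L)
                              (slice-unique zeroSym L u) (slice-unique oneSym L u))
    from-union : ∀ t → t ∈ union → Σ (Fin R) λ a → (a ∷ t) ∈ L
    from-union t t∈ with ∈-union t∈
    ... | inj₁ t∈₀ = zeroSym , slice-∈ zeroSym L t∈₀
    ... | inj₂ t∈₁ = oneSym , slice-∈ oneSym L t∈₁
    from-meet : ∀ t → t ∈ meet → (zeroSym ∷ t) ∈ L × (oneSym ∷ t) ∈ L
    from-meet t t∈ = let (t∈₀ , t∈₁) = ∈-meet t∈ in slice-∈ zeroSym L t∈₀ , slice-∈ oneSym L t∈₁
    -- The union of the 0- and 1-slices shatters no k+1 rows, their
    -- intersection no k rows (else row 0 extends it).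
    zero-one-slices : N zeroSym + N oneSym ≤ β m (suc k) + β m k
    zero-one-slices = begin
      N zeroSym + N oneSym          ≡⟨ size ⟩
      length union + length meet    ≤⟨ +-mono-≤
        (shatter-bound m (suc k) union union-unique (λ sh → ¬sh (shatters-tail (shatters-mono from-union sh))))
        (shatter-bound m k meet meet-unique (λ sh → ¬sh (shatters-extend (shatters-mono from-meet sh)))) ⟩
      β m (suc k) + β m k           ∎

  term : ℕ → ℕ → ℕ
  term m i = (m C i) * suc r' ^ (m ∸ i)

  term-step : ∀ m i → term (suc m) (suc i) ≡ term m i + suc r' * term m (suc i)
  term-step m i = begin
    (suc m C suc i) * s ^ (m ∸ i)          ≡⟨ cong (_* s ^ (m ∸ i)) (nCk+nC[k+1]≡[n+1]C[k+1] m i) ⟨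
    (m C i + m C suc i) * s ^ (m ∸ i)      ≡⟨ *-distribʳ-+ (s ^ (m ∸ i)) (m C i) _ ⟩
    term m i + (m C suc i) * s ^ (m ∸ i)   ≡⟨ cong (term m i +_) (shift (suc i ≤? m)) ⟩
    term m i + s * term m (suc i)          ∎
    where
    open ≡-Reasoning
    s : ℕ
    s = suc r'
    shift : Dec (suc i ≤ m) → (m C suc i) * s ^ (m ∸ i) ≡ s * term m (suc i)
    shift (yes i<m) = begin
      (m C suc i) * s ^ (m ∸ i)           ≡⟨ cong (λ z → (m C suc i) * s ^ z) (+-∸-assoc 1 i<m) ⟩
      (m C suc i) * (s * s ^ (m ∸ suc i)) ≡⟨ solve 3 (λ a b c → a :* (b :* c) := b :* (a :* c))
                                                refl (m C suc i) s (s ^ (m ∸ suc i)) ⟩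
      s * term m (suc i)                  ∎
    shift (no i≮m) rewrite k>n⇒nCk≡0 (≰⇒> i≮m) = sym (*-zeroʳ s)

  -- β satisfies the recurrence of the closed form: Pascal's rule term by term.
  β≡sumBelow : ∀ m k → β m k ≡ sumBelow (term m) k
  β≡sumBelow m       zero    = refl
  β≡sumBelow zero    (suc k) = cong suc (sym (sumBelow-zero k))
  β≡sumBelow (suc m) (suc k) = sym (begin
    term (suc m) 0 + sumBelow (λ i → term (suc m) (suc i)) k
      ≡⟨ cong₂ _+_ (term-zero m) (sumBelow-cong k (term-step m)) ⟩
    s * term m 0 + sumBelow (λ i → term m i + s * term m (suc i)) k
      ≡⟨ cong (s * term m 0 +_) (sumBelow-+ (term m) _ k) ⟩
    s * term m 0 + (sumBelow (term m) k + sumBelow (λ i → s * term m (suc i)) k)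
      ≡⟨ cong (λ z → s * term m 0 + (sumBelow (term m) k + z)) (sumBelow-* s _ k) ⟩
    s * term m 0 + (sumBelow (term m) k + s * sumBelow (λ i → term m (suc i)) k)
      ≡⟨ solve 4 (λ a b c d → a :* b :+ (c :+ a :* d) := a :* (b :+ d) :+ c)
           refl s (term m 0) (sumBelow (term m) k) (sumBelow (λ i → term m (suc i)) k) ⟩
    s * sumBelow (term m) (suc k) + sumBelow (term m) k
      ≡⟨ cong₂ (λ u v → s * u + v) (β≡sumBelow m (suc k)) (β≡sumBelow m k) ⟨
    β (suc m) (suc k) ∎)
    where
    open ≡-Reasoning
    s : ℕ
    s = suc r'
    term-zero : ∀ m → term (suc m) 0 ≡ s * term m 0
    term-zero m = solve 2 (λ a p → con 1 :* (a :* p) := a :* (con 1 :* p)) refl s (s ^ m)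

  β≡bound : ∀ m k → β m k ≡ bound m R k
  β≡bound m k = trans (β≡sumBelow m k) (sym (sum-applyUpTo (term m) (λ i → i) k))

  column : ∀ {m n} → Matrix m n R → Fin n → Column m
  column A j = Vec.tabulate (λ i → A i j)

  columns : ∀ {m n} → Matrix m n R → List (Column m)
  columns A = List.tabulate (column A)

  lookup-column : ∀ {m n} (A : Matrix m n R) j i → lookup (column A j) i ≡ A i j
  lookup-column A j i = lookup∘tabulate (λ i → A i j) i

  length-columns : ∀ {m n} (A : Matrix m n R) → length (columns A) ≡ n
  length-columns A = length-tabulate (column A)

  column-injective : ∀ {m n} (A : Matrix m n R) → Simple A → ∀ {j j'} → column A j ≡ column A j' → j ≡ j'
  column-injective A simple {j} {j'} e =
    simple j j' (λ i → trans (sym (lookup-column A j i)) (trans (cong (λ v → lookup v i) e) (lookup-column A j' i)))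

  columns-unique : ∀ {m n} (A : Matrix m n R) → Simple A → Unique (columns A)
  columns-unique A simple = Uniqueₚ.tabulate⁺ (column-injective A simple)

  digits-distinguish : ∀ {m n k l} (A : Matrix m n R) (ρ : Fin k → Fin m) (γ : Fin l → Fin n)
    (c : Fin l → Fin (2 ^ k)) → (∀ j i → toℕ (A (ρ i) (γ j)) ≡ bit (toℕ (c j)) (toℕ i)) →
    ∀ {j j'} → γ j ≡ γ j' → c j ≡ c j'
  digits-distinguish {k = k} A ρ γ c shows {j} {j'} e = Finₚ.toℕ-injective
    (bit-injective k _ _ (Finₚ.toℕ<n (c j)) (Finₚ.toℕ<n (c j'))
      (λ i → trans (sym (shows j i)) (trans (cong (λ z → toℕ (A (ρ i) z)) e) (shows j' i))))

  shatters⇒contains-K : ∀ {m n k} (A : Matrix m n R) → Shatters (_∈ columns A) k → Contains A (K k)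
  shatters⇒contains-K {m} {n} {k} A (ρ , inj , shown) =
    ρ , γ , inj , digits-distinguish A ρ γ (λ j → j) shows , (λ i j → shows j i)
    where
    γ : Fin (2 ^ k) → Fin n
    γ j = proj₁ (∈-tabulate⁻ (proj₁ (proj₂ (shown (patternOf j)))))
    shows : ∀ j i → toℕ (A (ρ i) (γ j)) ≡ bit (toℕ j) (toℕ i)
    shows j i with shown (patternOf j)
    ... | x , x∈ , sh with ∈-tabulate⁻ x∈
    ...   | c , refl = trans (cong toℕ (sym (lookup-column A c (ρ i)))) (trans (sh i) (Finₚ.toℕ-fromℕ< _))

  K-upper : ∀ m k n (A : Matrix m n R) → Simple A → Avoids A (K k) → n ≤ β m k
  K-upper m k n A simple avoids = subst (_≤ β m k) (length-columns A)
    (shatter-bound m k (columns A) (columns-unique A simple) (λ sh → avoids (shatters⇒contains-K A sh)))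

  listColumn : ∀ {m v} (Ls : List (Column m)) → length Ls ≡ v → Fin v → Column m
  listColumn Ls e j = List.lookup Ls (cast (sym e) j)

  fromColumns : ∀ {m v} (Ls : List (Column m)) → length Ls ≡ v → Matrix m v R
  fromColumns Ls e i j = lookup (listColumn Ls e j) i

  listColumn-∈ : ∀ {m v} (Ls : List (Column m)) (e : length Ls ≡ v) j → listColumn Ls e j ∈ Ls
  listColumn-∈ Ls e j = ∈-lookup (cast (sym e) j)

  listColumn-injective : ∀ {m v} (Ls : List (Column m)) (e : length Ls ≡ v) → Unique Ls →
    ∀ {j j'} → listColumn Ls e j ≡ listColumn Ls e j' → j ≡ j'
  listColumn-injective Ls e u {j} {j'} same = Finₚ.toℕ-injective (begin
    toℕ j                 ≡⟨ Finₚ.toℕ-cast (sym e) j ⟨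
    toℕ (cast (sym e) j)  ≡⟨ cong toℕ (unique-lookup-injective Ls u same) ⟩
    toℕ (cast (sym e) j') ≡⟨ Finₚ.toℕ-cast (sym e) j' ⟩
    toℕ j'                ∎)
    where open ≡-Reasoning

  fromColumns-simple : ∀ {m v} (Ls : List (Column m)) (e : length Ls ≡ v) → Unique Ls →
    Simple (fromColumns Ls e)
  fromColumns-simple Ls e u j j' same = listColumn-injective Ls e u
    (trans (sym (tabulate∘lookup _)) (trans (tabulate-cong same) (tabulate∘lookup _)))

  column-fromColumns-∈ : ∀ {m v} (Ls : List (Column m)) (e : length Ls ≡ v) j →
    column (fromColumns Ls e) j ∈ Ls
  column-fromColumns-∈ Ls e j = subst (_∈ Ls) (sym (tabulate∘lookup _)) (listColumn-∈ Ls e j)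

  prefixed : ∀ {m} n → (Fin n → Fin R) → List (Column m) → List (Column (suc m))
  prefixed zero    f L = []
  prefixed (suc n) f L = map (f fz ∷_) L ++ prefixed n (λ a → f (fs a)) L

  length-prefixed : ∀ {m} n f (L : List (Column m)) → length (prefixed n f L) ≡ n * length L
  length-prefixed zero    f L = refl
  length-prefixed (suc n) f L =
    trans (length-++ (map (f fz ∷_) L)) (cong₂ _+_ (length-map _ L) (length-prefixed n _ L))

  ∈-prefixed : ∀ {m} n f (L : List (Column m)) {x} → x ∈ prefixed n f L →
    Σ (Fin n) λ a → Σ (Column m) λ t → x ≡ f a ∷ t × t ∈ L
  ∈-prefixed (suc n) f L x∈ with ∈-++⁻ (map (f fz ∷_) L) x∈
  ... | inj₁ q with ∈-map⁻ (f fz ∷_) q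
  ...   | t , t∈ , e = fz , t , e , t∈
  ∈-prefixed (suc n) f L x∈ | inj₂ q with ∈-prefixed n (λ a → f (fs a)) L q
  ... | a , t , e , t∈ = fs a , t , e , t∈

  prefixed-unique : ∀ {m} n f (L : List (Column m)) → Inj f → Unique L → Unique (prefixed n f L)
  prefixed-unique zero    f L inj u = []
  prefixed-unique (suc n) f L inj u = Uniqueₚ.++⁺ (Uniqueₚ.map⁺ ∷-injectiveʳ u)
    (prefixed-unique n _ L (λ e → Finₚ.suc-injective (inj e)) u) disjoint
    where
    disjoint : ∀ {x} → x ∈ map (f fz ∷_) L × x ∈ prefixed n (λ a → f (fs a)) L → ⊥
    disjoint (p , q) with ∈-map⁻ (f fz ∷_) p | ∈-prefixed n (λ a → f (fs a)) L q
    ... | t , _ , refl | a , t' , e , _ = Finₚ.0≢1+n (inj (∷-injectiveˡ e))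

  nonzeroSym : Fin (suc r') → Fin R
  nonzeroSym = fs

  fewZeros : (m k : ℕ) → List (Column m)
  fewZeros m       zero    = []
  fewZeros zero    (suc k) = [] ∷ []
  fewZeros (suc m) (suc k) =
    map (zeroSym ∷_) (fewZeros m k) ++ prefixed (suc r') nonzeroSym (fewZeros m (suc k))

  length-fewZeros : ∀ m k → length (fewZeros m k) ≡ β m k
  length-fewZeros m       zero    = refl
  length-fewZeros zero    (suc k) = refl
  length-fewZeros (suc m) (suc k) = begin
    length (fewZeros (suc m) (suc k))
      ≡⟨ length-++ (map (zeroSym ∷_) (fewZeros m k)) ⟩
    length (map (zeroSym ∷_) (fewZeros m k)) + length (prefixed (suc r') nonzeroSym (fewZeros m (suc k)))
      ≡⟨ cong₂ _+_ (length-map _ (fewZeros m k)) (length-prefixed (suc r') nonzeroSym (fewZeros m (suc k))) ⟩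
    length (fewZeros m k) + suc r' * length (fewZeros m (suc k))
      ≡⟨ cong₂ (λ a b → a + suc r' * b) (length-fewZeros m k) (length-fewZeros m (suc k)) ⟩
    β m k + suc r' * β m (suc k)
      ≡⟨ +-comm (β m k) _ ⟩
    β (suc m) (suc k) ∎
    where open ≡-Reasoning

  fewZeros-zeros : ∀ m k {x} → x ∈ fewZeros m k → zeros x < k
  fewZeros-zeros zero    (suc k) (here refl) = s≤s z≤n
  fewZeros-zeros (suc m) (suc k) x∈ with ∈-++⁻ (map (zeroSym ∷_) (fewZeros m k)) x∈
  ... | inj₁ q with ∈-map⁻ (zeroSym ∷_) q
  ...   | t , t∈ , refl = s≤s (fewZeros-zeros m k t∈)
  fewZeros-zeros (suc m) (suc k) x∈ | inj₂ q with ∈-prefixed (suc r') nonzeroSym (fewZeros m (suc k)) q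
  ... | a , t , refl , t∈ = fewZeros-zeros m (suc k) t∈

  fewZeros-unique : ∀ m k → Unique (fewZeros m k)
  fewZeros-unique m       zero    = []
  fewZeros-unique zero    (suc k) = [] ∷ []
  fewZeros-unique (suc m) (suc k) = Uniqueₚ.++⁺ (Uniqueₚ.map⁺ ∷-injectiveʳ (fewZeros-unique m k))
    (prefixed-unique (suc r') nonzeroSym _ Finₚ.suc-injective (fewZeros-unique m (suc k))) disjoint
    where
    disjoint : ∀ {x} → x ∈ map (zeroSym ∷_) (fewZeros m k) × x ∈ prefixed (suc r') nonzeroSym (fewZeros m (suc k)) → ⊥
    disjoint (p , q) with ∈-map⁻ (zeroSym ∷_) p | ∈-prefixed (suc r') nonzeroSym (fewZeros m (suc k)) q
    ... | t , _ , refl | a , t' , e , _ = Finₚ.0≢1+n (∷-injectiveˡ e)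

  toℕ≡0 : ∀ {n} {x : Fin (suc n)} → toℕ x ≡ 0 → x ≡ fz
  toℕ≡0 {x = fz} _ = refl

  copy-zeros : ∀ {m n k l} (A : Matrix m n R) (ρ : Fin k → Fin m) (γ : Fin l → Fin n) (c : Fin l) →
    (∀ i → toℕ (A (ρ i) (γ c)) ≡ bit (toℕ c) (toℕ i)) → (q : ℕ) → toℕ c ≡ q * 2 ^ k →
    ∀ i → lookup (column A (γ c)) (ρ i) ≡ fz
  copy-zeros {k = k} A ρ γ c shows q c≡ i = trans (lookup-column A (γ c) (ρ i)) (toℕ≡0 (begin
    toℕ (A (ρ i) (γ c))        ≡⟨ shows i ⟩
    bit (toℕ c) (toℕ i)        ≡⟨ cong (λ z → bit z (toℕ i)) c≡ ⟩
    bit (0 + q * 2 ^ k) (toℕ i) ≡⟨ bit-+-multiple k i 0 q ⟩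
    bit 0 (toℕ i)              ≡⟨ bit-of-0 (toℕ i) ⟩
    0                          ∎))
    where open ≡-Reasoning

  K-lower : ∀ m k → Σ (Matrix m (β m k) R) λ A → Simple A × Avoids A (K k)
  K-lower m k = A , fromColumns-simple (fewZeros m k) (length-fewZeros m k) (fewZeros-unique m k) , avoids
    where
    A : Matrix m (β m k) R
    A = fromColumns (fewZeros m k) (length-fewZeros m k)
    avoids : Avoids A (K k)
    avoids (ρ , γ , ρ-inj , γ-inj , shows) = <⇒≱ (fewZeros-zeros m k (column-fromColumns-∈ (fewZeros m k) (length-fewZeros m k) (γ c0)))
      (zeros-≥ m k x ρ ρ-inj (copy-zeros A ρ γ c0 (λ i → shows i c0) 0 (Finₚ.toℕ-fromℕ< _)))
      where
      c0 : Fin (2 ^ k)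
      c0 = fromℕ< (m^n>0 2 k)
      x : Column m
      x = column A (γ c0)

  matching : ∀ {m n k} (A : Matrix m n R) → Vec (Fin m) k → Fin (2 ^ k) → List (Column m)
  matching A σ j = filter (λ x → shows? x (lookup σ) (patternOf j)) (columns A)

  -- If on the k distinct rows σ every pattern is shown by at least p columns,
  -- then A contains p·K_k: column c = j + q·2^k of p·K_k (j < 2^k, q < p) is
  -- served by the q-th column of A showing the pattern of j.
  many-matches⇒contains-pK : ∀ {m n k} p (A : Matrix m n R) → Simple A → (σ : Vec (Fin m) k) →
    Inj (lookup σ) → (∀ j → p ≤ length (matching A σ j)) → Contains A (pK p k)
  many-matches⇒contains-pK {m} {n} {k} p A simple σ inj many =
    lookup σ , γ , inj , γ-injective , (λ i c → shows c i)
    where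
    instance
      2^k≢0 : NonZero (2 ^ k)
      2^k≢0 = m^n≢0 2 k
    residue : Fin (p * 2 ^ k) → Fin (2 ^ k)
    residue c = fromℕ< (m%n<n (toℕ c) (2 ^ k))
    quotient : Fin (p * 2 ^ k) → ℕ
    quotient c = toℕ c / 2 ^ k
    decompose : ∀ c → toℕ c ≡ toℕ (residue c) + quotient c * 2 ^ k
    decompose c = trans (m≡m%n+[m/n]*n (toℕ c) (2 ^ k)) (cong (_+ quotient c * 2 ^ k) (sym (Finₚ.toℕ-fromℕ< _)))
    index : ∀ c → Fin (length (matching A σ (residue c)))
    index c = fromℕ< (<-≤-trans (m<n*o⇒m/o<n (Finₚ.toℕ<n c)) (many (residue c)))
    chosen : Fin (p * 2 ^ k) → Column m
    chosen c = List.lookup (matching A σ (residue c)) (index c)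
    chosen-∈ : ∀ c → chosen c ∈ columns A × Shows (chosen c) (lookup σ) (patternOf (residue c))
    chosen-∈ c = ∈-filter⁻ (λ x → shows? x (lookup σ) (patternOf (residue c))) {xs = columns A} (∈-lookup (index c))
    γ : Fin (p * 2 ^ k) → Fin n
    γ c = proj₁ (∈-tabulate⁻ (proj₁ (chosen-∈ c)))
    chosen≡column : ∀ c → chosen c ≡ column A (γ c)
    chosen≡column c = proj₂ (∈-tabulate⁻ (proj₁ (chosen-∈ c)))
    shows-residue : ∀ c i → toℕ (A (lookup σ i) (γ c)) ≡ bit (toℕ (residue c)) (toℕ i)
    shows-residue c i = begin
      toℕ (A (lookup σ i) (γ c))              ≡⟨ cong toℕ (lookup-column A (γ c) (lookup σ i)) ⟨
      toℕ (lookup (column A (γ c)) (lookup σ i)) ≡⟨ cong (λ v → toℕ (lookup v (lookup σ i))) (chosen≡column c) ⟨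
      toℕ (lookup (chosen c) (lookup σ i))    ≡⟨ proj₂ (chosen-∈ c) i ⟩
      toℕ (patternOf (residue c) i)           ≡⟨ Finₚ.toℕ-fromℕ< _ ⟩
      bit (toℕ (residue c)) (toℕ i)           ∎
      where open ≡-Reasoning
    shows : ∀ c i → toℕ (A (lookup σ i) (γ c)) ≡ bit (toℕ c) (toℕ i)
    shows c i = trans (shows-residue c i) (sym (trans (cong (λ z → bit z (toℕ i)) (decompose c))
                                                     (bit-+-multiple k i (toℕ (residue c)) (quotient c))))
    same-position : ∀ {j j'} → j ≡ j' → ∀ a a' →
      List.lookup (matching A σ j) a ≡ List.lookup (matching A σ j') a' → toℕ a ≡ toℕ a'
    same-position {j} refl a a' e =
      cong toℕ (unique-lookup-injective (matching A σ j) (Uniqueₚ.filter⁺ _ (columns-unique A simple)) e)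
    γ-injective : Inj γ
    γ-injective {c} {c'} e = Finₚ.toℕ-injective (begin
      toℕ c                                    ≡⟨ decompose c ⟩
      toℕ (residue c) + quotient c * 2 ^ k     ≡⟨ cong₂ (λ u v → u + v * 2 ^ k) (cong toℕ same-residue) same-quotient ⟩
      toℕ (residue c') + quotient c' * 2 ^ k   ≡⟨ decompose c' ⟨
      toℕ c'                                   ∎)
      where
      open ≡-Reasoning
      same-residue : residue c ≡ residue c'
      same-residue = digits-distinguish A (lookup σ) γ residue shows-residue e
      same-quotient : quotient c ≡ quotient c'
      same-quotient = trans (sym (Finₚ.toℕ-fromℕ< _))
        (trans (same-position same-residue (index c) (index c')
                 (trans (chosen≡column c) (trans (cong (column A) e) (sym (chosen≡column c')))))
               (Finₚ.toℕ-fromℕ< _))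

  rarePattern : ∀ {m n k} p (A : Matrix m n R) → Simple A → Avoids A (pK p k) →
    (σ : Vec (Fin m) k) → Σ (Fin (2 ^ k)) λ j → Inj (lookup σ) → length (matching A σ j) < p
  rarePattern {k = k} p A simple avoids σ with Finₚ.any? (λ j → length (matching A σ j) <? p)
  ... | yes (j , rare) = j , λ _ → rare
  ... | no none-rare = fromℕ< (m^n>0 2 k) , λ inj →
    ⊥-elim (avoids (many-matches⇒contains-pK p A simple σ inj (λ j → ≮⇒≥ (λ rare → none-rare (j , rare)))))

  -- Upper bound for p·K_k: delete, for every k-set of rows σ, the fewer than p
  -- columns showing the rare pattern of σ; what remains shatters no k rows.
  pK-upper : ∀ m k p n (A : Matrix m n R) → Simple A → Avoids A (pK p k) → n ≤ β m k + (p ∸ 1) * (m C k)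
  pK-upper m k p n A simple avoids = begin
    n                    ≡⟨ length-columns A ⟨
    length (columns A)   ≤⟨ length-≤-survivors+caught isRare? (increasing m k) (columns A) ⟩
    length rest + sum (map (λ σ → length (filter (isRare? σ) (columns A))) (increasing m k))
                         ≤⟨ +-mono-≤ (shatter-bound m k rest (Uniqueₚ.filter⁺ _ (columns-unique A simple)) rest-shatters-nothing)
                                     (sum-≤-length* _ (increasing m k) (p ∸ 1) few-rare) ⟩
    β m k + length (increasing m k) * (p ∸ 1)
                         ≡⟨ cong (λ z → β m k + z * (p ∸ 1)) (length-increasing m k) ⟩
    β m k + (m C k) * (p ∸ 1)
                         ≡⟨ cong (β m k +_) (*-comm (m C k) (p ∸ 1)) ⟩
    β m k + (p ∸ 1) * (m C k) ∎
    where
    open ≤-Reasoning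
    rare : Vec (Fin m) k → Fin (2 ^ k)
    rare σ = proj₁ (rarePattern p A simple avoids σ)
    isRare? : ∀ σ x → Dec (Shows x (lookup σ) (patternOf (rare σ)))
    isRare? σ x = shows? x (lookup σ) (patternOf (rare σ))
    rest : List (Column m)
    rest = survivors isRare? (increasing m k) (columns A)
    few-rare : ∀ {σ} → σ ∈ increasing m k → length (filter (isRare? σ) (columns A)) ≤ p ∸ 1
    few-rare {σ} σ∈ = <⇒≤pred (proj₂ (rarePattern p A simple avoids σ) (increasing-injective m k σ∈))
    -- Shattered rows ρ = σ ∘ π would make some survivor show the rare pattern of σ.
    rest-shatters-nothing : ¬ Shatters (_∈ rest) k
    rest-shatters-nothing (ρ , inj , shown) with factorise m k ρ inj
    ... | factorisation σ σ∈ π onto ρ≡σ∘π with shown (λ i → patternOf (rare σ) (π i))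
    ...   | x , x∈ , sh = All.lookup (proj₂ (∈-filter⁻ (λ x → All.all? (λ σ → ¬? (isRare? σ x)) (increasing m k)) {xs = columns A} x∈)) σ∈ shows-rare
      where
      shows-rare : Shows x (lookup σ) (patternOf (rare σ))
      shows-rare i' with onto i'
      ... | i , refl = trans (cong (λ z → toℕ (lookup x z)) (sym (ρ≡σ∘π i))) (sh i)

  isZero : Fin R → Bool
  isZero fz     = true
  isZero (fs _) = false

  zeroSet : ∀ {m} → Column m → Vec Bool m
  zeroSet = Vec.map isZero

  trues falses : ∀ {m} → Vec Bool m → ℕ
  trues []          = 0
  trues (true ∷ s)  = suc (trues s)
  trues (false ∷ s) = trues s
  falses []          = 0
  falses (true ∷ s)  = falses s
  falses (false ∷ s) = suc (falses s)

  trues+falses : ∀ {m} (s : Vec Bool m) → trues s + falses s ≡ m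
  trues+falses []          = refl
  trues+falses (true ∷ s)  = cong suc (trues+falses s)
  trues+falses (false ∷ s) = trans (+-suc (trues s) _) (cong suc (trues+falses s))

  zeros≡trues : ∀ {m} (x : Column m) → zeros x ≡ trues (zeroSet x)
  zeros≡trues []         = refl
  zeros≡trues (fz ∷ x)   = cong suc (zeros≡trues x)
  zeros≡trues (fs _ ∷ x) = zeros≡trues x

  zero⇒in-image : ∀ {m k} (ρ : Fin k → Fin m) → Inj ρ → (x : Column m) →
    (∀ j → lookup x (ρ j) ≡ fz) → zeros x ≡ k → ∀ i → lookup x i ≡ fz → Σ (Fin k) λ j → ρ j ≡ i
  zero⇒in-image {m} {k} ρ inj x vanish count i xi≡0 with Finₚ.any? (λ j → ρ j Finₚ.≟ i)
  ... | yes hit  = hit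
  ... | no miss = ⊥-elim (1+n≰n (subst (suc k ≤_) count
      (zeros-≥ m (suc k) x (extend i ρ) (extend-injective i ρ inj (λ j e → miss (j , e))) vanish⁺)))
    where
    vanish⁺ : ∀ j → lookup x (extend i ρ j) ≡ fz
    vanish⁺ fz     = xi≡0
    vanish⁺ (fs j) = vanish j

  zeroSet-determined : ∀ {m k} (ρ : Fin k → Fin m) → Inj ρ → ∀ (x y : Column m) →
    (∀ j → lookup x (ρ j) ≡ fz) → zeros x ≡ k → (∀ j → lookup y (ρ j) ≡ fz) → zeros y ≡ k →
    zeroSet x ≡ zeroSet y
  zeroSet-determined {m} {k} ρ inj x y vanishX countX vanishY countY = begin
    Vec.map isZero x                      ≡⟨ tabulate∘lookup _ ⟨
    Vec.tabulate (lookup (Vec.map isZero x)) ≡⟨ tabulate-cong same ⟩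
    Vec.tabulate (lookup (Vec.map isZero y)) ≡⟨ tabulate∘lookup _ ⟩
    Vec.map isZero y                      ∎
    where
    open ≡-Reasoning
    one-sided : ∀ (x y : Column m) → (∀ j → lookup x (ρ j) ≡ fz) → zeros x ≡ k →
      (∀ j → lookup y (ρ j) ≡ fz) → ∀ i → lookup x i ≡ fz → ∀ {a} → lookup y i ≢ fs a
    one-sided x y vx cx vy i xi≡0 yi≡a with zero⇒in-image ρ inj x vx cx i xi≡0
    ... | j , refl = Finₚ.0≢1+n (trans (sym (vy j)) yi≡a)
    same : ∀ i → lookup (Vec.map isZero x) i ≡ lookup (Vec.map isZero y) i
    same i rewrite lookup-map i isZero x | lookup-map i isZero y with lookup x i in xi | lookup y i in yi
    ... | fz   | fz   = refl
    ... | fs _ | fs _ = refl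
    ... | fz   | fs _ = ⊥-elim (one-sided x y vanishX countX vanishY i xi yi)
    ... | fs _ | fz   = ⊥-elim (one-sided y x vanishY countY vanishX i yi xi)

  withZeroSet : ∀ {m} → Vec Bool m → List (Column m)
  withZeroSet []          = [] ∷ []
  withZeroSet (true ∷ s)  = map (zeroSym ∷_) (withZeroSet s)
  withZeroSet (false ∷ s) = prefixed (suc r') nonzeroSym (withZeroSet s)

  length-withZeroSet : ∀ {m} (s : Vec Bool m) → length (withZeroSet s) ≡ suc r' ^ falses s
  length-withZeroSet []          = refl
  length-withZeroSet (true ∷ s)  = trans (length-map _ (withZeroSet s)) (length-withZeroSet s)
  length-withZeroSet (false ∷ s) =
    trans (length-prefixed (suc r') nonzeroSym (withZeroSet s)) (cong (suc r' *_) (length-withZeroSet s))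

  withZeroSet-zeroSet : ∀ {m} (s : Vec Bool m) {x} → x ∈ withZeroSet s → zeroSet x ≡ s
  withZeroSet-zeroSet []          (here refl) = refl
  withZeroSet-zeroSet (true ∷ s)  x∈ with ∈-map⁻ (zeroSym ∷_) x∈
  ... | t , t∈ , refl = cong (true ∷_) (withZeroSet-zeroSet s t∈)
  withZeroSet-zeroSet (false ∷ s) x∈ with ∈-prefixed (suc r') nonzeroSym (withZeroSet s) x∈
  ... | a , t , refl , t∈ = cong (false ∷_) (withZeroSet-zeroSet s t∈)

  withZeroSet-unique : ∀ {m} (s : Vec Bool m) → Unique (withZeroSet s)
  withZeroSet-unique []          = [] ∷ []
  withZeroSet-unique (true ∷ s)  = Uniqueₚ.map⁺ ∷-injectiveʳ (withZeroSet-unique s)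
  withZeroSet-unique (false ∷ s) = prefixed-unique (suc r') nonzeroSym _ Finₚ.suc-injective (withZeroSet-unique s)

  ofWeight : (m k : ℕ) → List (Vec Bool m)
  ofWeight zero    zero    = [] ∷ []
  ofWeight zero    (suc k) = []
  ofWeight (suc m) zero    = map (false ∷_) (ofWeight m zero)
  ofWeight (suc m) (suc k) = map (true ∷_) (ofWeight m k) ++ map (false ∷_) (ofWeight m (suc k))

  length-ofWeight : ∀ m k → length (ofWeight m k) ≡ m C k
  length-ofWeight zero    zero    = refl
  length-ofWeight zero    (suc k) = refl
  length-ofWeight (suc m) zero    = trans (length-map _ (ofWeight m zero)) (length-ofWeight m zero)
  length-ofWeight (suc m) (suc k) = begin
    length (map (true ∷_) (ofWeight m k) ++ map (false ∷_) (ofWeight m (suc k)))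
      ≡⟨ length-++ (map (true ∷_) (ofWeight m k)) ⟩
    length (map (true ∷_) (ofWeight m k)) + length (map (false ∷_) (ofWeight m (suc k)))
      ≡⟨ cong₂ _+_ (length-map _ (ofWeight m k)) (length-map _ (ofWeight m (suc k))) ⟩
    length (ofWeight m k) + length (ofWeight m (suc k))
      ≡⟨ cong₂ _+_ (length-ofWeight m k) (length-ofWeight m (suc k)) ⟩
    m C k + m C suc k
      ≡⟨ nCk+nC[k+1]≡[n+1]C[k+1] m k ⟩
    suc m C suc k ∎
    where open ≡-Reasoning

  ofWeight-trues : ∀ m k {s} → s ∈ ofWeight m k → trues s ≡ k
  ofWeight-trues zero    zero    (here refl) = refl
  ofWeight-trues (suc m) zero    s∈ with ∈-map⁻ (false ∷_) s∈
  ... | t , t∈ , refl = ofWeight-trues m zero t∈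
  ofWeight-trues (suc m) (suc k) s∈ with ∈-++⁻ (map (true ∷_) (ofWeight m k)) s∈
  ... | inj₁ q with ∈-map⁻ (true ∷_) q
  ...   | t , t∈ , refl = cong suc (ofWeight-trues m k t∈)
  ofWeight-trues (suc m) (suc k) s∈ | inj₂ q with ∈-map⁻ (false ∷_) q
  ...   | t , t∈ , refl = ofWeight-trues m (suc k) t∈

  ofWeight-falses : ∀ m k {s} → s ∈ ofWeight m k → falses s ≡ m ∸ k
  ofWeight-falses m k {s} s∈ =
    trans (sym (m+n∸m≡n (trues s) (falses s))) (cong₂ _∸_ (trues+falses s) (ofWeight-trues m k s∈))

  ofWeight-unique : ∀ m k → Unique (ofWeight m k)
  ofWeight-unique zero    zero    = [] ∷ []
  ofWeight-unique zero    (suc k) = []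
  ofWeight-unique (suc m) zero    = Uniqueₚ.map⁺ ∷-injectiveʳ (ofWeight-unique m zero)
  ofWeight-unique (suc m) (suc k) = Uniqueₚ.++⁺ (Uniqueₚ.map⁺ ∷-injectiveʳ (ofWeight-unique m k))
    (Uniqueₚ.map⁺ ∷-injectiveʳ (ofWeight-unique m (suc k))) disjoint
    where
    disjoint : ∀ {s} → s ∈ map (true ∷_) (ofWeight m k) × s ∈ map (false ∷_) (ofWeight m (suc k)) → ⊥
    disjoint (p , q) with ∈-map⁻ (true ∷_) p | ∈-map⁻ (false ∷_) q
    ... | t , _ , refl | t' , _ , ()

  block : ℕ → ∀ {m} → Vec Bool m → List (Column m)
  block p s = take (p ∸ 1) (withZeroSet s)

  length-block : ∀ m k p {s} → p ∸ 1 ≤ suc r' ^ (m ∸ k) → s ∈ ofWeight m k → length (block p s) ≡ p ∸ 1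
  length-block m k p {s} room s∈ = trans (length-take (p ∸ 1) (withZeroSet s)) (m≤n⇒m⊓n≡m enough)
    where
    enough : p ∸ 1 ≤ length (withZeroSet s)
    enough = subst (p ∸ 1 ≤_) (sym (trans (length-withZeroSet s) (cong (suc r' ^_) (ofWeight-falses m k s∈)))) room

  block-zeroSet : ∀ p {m} (s : Vec Bool m) {x} → x ∈ block p s → zeroSet x ≡ s
  block-zeroSet p s x∈ = withZeroSet-zeroSet s (∈-take (p ∸ 1) (withZeroSet s) x∈)

  blocks : ℕ → ∀ {m} → List (Vec Bool m) → List (Column m)
  blocks p ss = concat (map (block p) ss)

  ∈-blocks : ∀ p {m} (ss : List (Vec Bool m)) {x} → x ∈ blocks p ss → Σ (Vec Bool m) λ s → s ∈ ss × x ∈ block p s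
  ∈-blocks p ss x∈ with ∈-concat⁻′ (map (block p) ss) x∈
  ... | xs , x∈xs , xs∈ with ∈-map⁻ (block p) xs∈
  ...   | s , s∈ , refl = s , s∈ , x∈xs

  blocks-unique : ∀ p {m} (ss : List (Vec Bool m)) → Unique ss → Unique (blocks p ss)
  blocks-unique p []       _           = []
  blocks-unique p (s ∷ ss) (fresh ∷ u) =
    Uniqueₚ.++⁺ (Uniqueₚ.take⁺ (p ∸ 1) (withZeroSet-unique s)) (blocks-unique p ss u) disjoint
    where
    disjoint : ∀ {x} → x ∈ block p s × x ∈ blocks p ss → ⊥
    disjoint (x∈ , x∈′) with ∈-blocks p ss x∈′
    ... | s' , s'∈ , x∈″ = All.lookup fresh s'∈ (trans (sym (block-zeroSet p s x∈)) (block-zeroSet p s' x∈″))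

  length-blocks : ∀ m k p (ss : List (Vec Bool m)) → p ∸ 1 ≤ suc r' ^ (m ∸ k) →
    (∀ {s} → s ∈ ss → s ∈ ofWeight m k) → length (blocks p ss) ≡ length ss * (p ∸ 1)
  length-blocks m k p []       room weight = refl
  length-blocks m k p (s ∷ ss) room weight = trans (length-++ (block p s))
    (cong₂ _+_ (length-block m k p room (weight (here refl))) (length-blocks m k p ss room (λ s∈ → weight (there s∈))))

  blocks-zeros : ∀ m k p {x} → x ∈ blocks p (ofWeight m k) → zeros x ≡ k
  blocks-zeros m k p {x} x∈ with ∈-blocks p (ofWeight m k) x∈
  ... | s , s∈ , x∈s = trans (zeros≡trues x) (trans (cong trues (block-zeroSet p s x∈s)) (ofWeight-trues m k s∈))

  extremal : ∀ m k p → List (Column m)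
  extremal m k p = fewZeros m k ++ blocks p (ofWeight m k)

  -- The extremal family is duplicate-free (its two parts differ in the number
  -- of zeros) and has β(m,k) + (p-1)·C(m,k) members.
  extremal-unique : ∀ m k p → Unique (extremal m k p)
  extremal-unique m k p = Uniqueₚ.++⁺ (fewZeros-unique m k) (blocks-unique p _ (ofWeight-unique m k))
    (λ (x∈₁ , x∈₂) → <⇒≢ (fewZeros-zeros m k x∈₁) (blocks-zeros m k p x∈₂))

  length-extremal : ∀ m k p → p ∸ 1 ≤ suc r' ^ (m ∸ k) → length (extremal m k p) ≡ β m k + (p ∸ 1) * (m C k)
  length-extremal m k p room = begin
    length (extremal m k p)                                   ≡⟨ length-++ (fewZeros m k) ⟩
    length (fewZeros m k) + length (blocks p (ofWeight m k))  ≡⟨ cong₂ _+_ (length-fewZeros m k)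
                                                                 (length-blocks m k p (ofWeight m k) room (λ s∈ → s∈)) ⟩
    β m k + length (ofWeight m k) * (p ∸ 1)                   ≡⟨ cong (λ z → β m k + z * (p ∸ 1)) (length-ofWeight m k) ⟩
    β m k + (m C k) * (p ∸ 1)                                 ≡⟨ cong (β m k +_) (*-comm (m C k) (p ∸ 1)) ⟩
    β m k + (p ∸ 1) * (m C k)                                 ∎
    where open ≡-Reasoning

  -- The p all-zero columns t·2^k (t < p) of a copy of
  -- p·K_k would be distinct members of the extremal family vanishing on the k
  -- rows of the copy, hence all in the single block of those rows — which has
  -- only p-1 members.
  pK-lower : ∀ m k p → 1 ≤ p → p ∸ 1 ≤ suc r' ^ (m ∸ k) →
    Σ (Matrix m (β m k + (p ∸ 1) * (m C k)) R) λ A → Simple A × Avoids A (pK p k)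
  pK-lower m k p p≥1 room = A , simple , avoids
    where
    Ls : List (Column m)
    Ls = extremal m k p
    A : Matrix m (β m k + (p ∸ 1) * (m C k)) R
    A = fromColumns Ls (length-extremal m k p room)
    simple : Simple A
    simple = fromColumns-simple Ls (length-extremal m k p room) (extremal-unique m k p)
    avoids : Avoids A (pK p k)
    avoids (ρ , γ , ρ-inj , γ-inj , shows) = collision (Finₚ.pigeonhole fewer position)
      where
      allZero : Fin p → Fin (p * 2 ^ k)
      allZero t = fromℕ< (*-monoˡ-< (2 ^ k) {{m^n≢0 2 k}} (Finₚ.toℕ<n t))
      x : Fin p → Column m
      x t = column A (γ (allZero t))
      vanish : ∀ t i → lookup (x t) (ρ i) ≡ fz
      vanish t = copy-zeros A ρ γ (allZero t) (λ i → shows i (allZero t)) (toℕ t) (Finₚ.toℕ-fromℕ< _)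
      in-blocks : ∀ t → x t ∈ blocks p (ofWeight m k)
      in-blocks t with ∈-++⁻ (fewZeros m k) (column-fromColumns-∈ Ls (length-extremal m k p room) (γ (allZero t)))
      ... | inj₁ x∈ = ⊥-elim (<⇒≱ (fewZeros-zeros m k x∈) (zeros-≥ m k (x t) ρ ρ-inj (vanish t)))
      ... | inj₂ x∈ = x∈
      t₀ : Fin p
      t₀ = fromℕ< p≥1
      s₀ : Vec Bool m
      s₀ = zeroSet (x t₀)
      s₀∈ : s₀ ∈ ofWeight m k
      s₀∈ with ∈-blocks p (ofWeight m k) (in-blocks t₀)
      ... | s , s∈ , x∈ rewrite block-zeroSet p s x∈ = s∈
      in-block₀ : ∀ t → x t ∈ block p s₀
      in-block₀ t with ∈-blocks p (ofWeight m k) (in-blocks t)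
      ... | s , s∈ , x∈ = subst (λ z → x t ∈ block p z) s≡s₀ x∈
        where
        s≡s₀ : s ≡ s₀
        s≡s₀ = trans (sym (block-zeroSet p s x∈)) (zeroSet-determined ρ ρ-inj (x t) (x t₀) (vanish t)
                 (blocks-zeros m k p (in-blocks t)) (vanish t₀) (blocks-zeros m k p (in-blocks t₀)))
      position : Fin p → Fin (length (block p s₀))
      position t = Any.index (in-block₀ t)
      fewer : length (block p s₀) < p
      fewer = subst (_< p) (sym (length-block m k p room s₀∈)) (∸-monoʳ-< {p} {1} {0} (s≤s z≤n) p≥1)
      -- Two of the p columns occupy the same position of the block, so coincide.
      collision : Σ (Fin p) (λ t → Σ (Fin p) λ t' → t Fin.< t' × position t ≡ position t') → ⊥
      collision (t , t' , t<t' , same) = <⇒≢ t<t' (*-cancelʳ-≡ (toℕ t) (toℕ t') (2 ^ k) {{m^n≢0 2 k}} (begin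
        toℕ t * 2 ^ k          ≡⟨ Finₚ.toℕ-fromℕ< _ ⟨
        toℕ (allZero t)        ≡⟨ cong toℕ (γ-inj (column-injective A simple same-column)) ⟩
        toℕ (allZero t')       ≡⟨ Finₚ.toℕ-fromℕ< _ ⟩
        toℕ t' * 2 ^ k         ∎))
        where
        open ≡-Reasoning
        same-column : x t ≡ x t'
        same-column = trans (lookup-index (in-block₀ t))
          (trans (cong (List.lookup (block p s₀)) same) (sym (lookup-index (in-block₀ t'))))

proposition3p1 : (r k m : ℕ) → 2 ≤ r → 1 ≤ k → 1 ≤ m →
    ForbIs m r (K k) (bound m r k) ×
    ((p : ℕ) → 1 ≤ p → p ∸ 1 ≤ (r ∸ 1) ^ (m ∸ k) →
      ForbIs m r (pK p k) (bound m r k + (p ∸ 1) * (m C k)))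
proposition3p1 (suc (suc r')) k m (s≤s (s≤s z≤n)) _ _ = forb-K , forb-pK
  where
  open OverAlphabet r'
  forb-K : ForbIs m R (K k) (bound m R k)
  forb-K = subst (ForbIs m R (K k)) (β≡bound m k) (K-lower m k , K-upper m k)
  forb-pK : (p : ℕ) → 1 ≤ p → p ∸ 1 ≤ suc r' ^ (m ∸ k) →
    ForbIs m R (pK p k) (bound m R k + (p ∸ 1) * (m C k))
  forb-pK p p≥1 room = subst (λ v → ForbIs m R (pK p k) (v + (p ∸ 1) * (m C k))) (β≡bound m k)
    (pK-lower m k p p≥1 room , pK-upper m k p)
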